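{- Let $q$ be a prime power with $q-1=ml^2$ for integers $l,m\ge 2$. Let $\theta$ be a primitive element of $\mathbb{F}_q$, put $\beta=\theta^l$ and $C=\langle\beta^m\rangle=\langle\theta^{ml}\rangle\le\mathbb{F}_q^*$. Let $\sigma:\mathbb{Z}_m\to\mathbb{Z}_{ml}$ be an injective map, where elements of $\mathbb{Z}_{ml}$ are identified with their representatives in $\{0,\dots,ml-1\}$, and put $D_j=\theta^{\sigma(j)}C$ for $0\le j\le m-1$. Then for any non-empty subset $S\subseteq\{1,\dots,m-1\}$, the family $\{D_0,\dots,D_{m-1}\}$ is a $(q,m,l;|S|)$-$S$-CEDF in $(\mathbb{F}_q,+)$ if and only if every coset of $C$ in $\mathbb{F}_q^*$ contains exactly $|S|$ elements (counted with multiplicity) of the multiset $$\{\{\theta^{\sigma(j+c)}-\theta^{\sigma(j)}\beta^{mr}:\ 0\le j\le m-1,\ 0\le r\le l-1,\ c\in S\}\},$$ where $j+c$ is taken modulo $m$.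
   Context: Let $(G,+)$ be a finite abelian group of order $n$ (written additively), let $l,m\ge 2$, and let $S$ be a non-empty subset of $\{1,\dots,m-1\}$. For non-empty subsets $A,B\subseteq G$, $\Delta(A,B)$ denotes the multiset $\{\{a-b: a\in A, b\in B\}\}$. A family $\{A_0,\dots,A_{m-1}\}$ of $m$ pairwise disjoint subsets of $G$ is an $(n,m,l;\lambda)$-$S$-circular external difference family (CEDF) in $G$ if $|A_i|=l$ for all $i$ and each nonzero $g\in G$ occurs exactly $\lambda$ times in the multiset union $\bigcup_{c\in S}\bigcup_{i=0}^{m-1}\Delta(A_{i+c},A_i)$, where subscripts are taken modulo $m$. -}

module Defs where

open import Level using (Level; _⊔_)
open import Algebra.Bundles using (AbelianGroup; CommutativeRing; Semiring)
import Algebra.Definitions.RawSemiring as RawSemiringDefs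
open import Relation.Binary.Bundles using (Setoid; DecSetoid)
open import Relation.Binary.Definitions using (Decidable)
open import Relation.Binary.PropositionalEquality using (_≡_; _≢_)
open import Relation.Nullary using (¬_)
open import Data.Nat as ℕ using (ℕ; NonZero)
open import Data.Nat.DivMod using (_mod_)
open import Data.Fin using (Fin; toℕ)
open import Data.Fin.Subset using (Subset)
open import Data.Fin.Subset.Properties using (_∈?_)
open import Data.List using (List; length; map; filter; concatMap; allFin)
open import Data.Product using (Σ; ∃; _×_)
import Data.List.Membership.Setoid as SetoidMembership
import Data.List.Membership.DecSetoid as DecSetoidMembership
import Data.List.Relation.Unary.Unique.Setoid as SetoidUnique

HasSize : ∀ {c ℓ} → Setoid c ℓ → ℕ → Set (c ⊔ ℓ)
HasSize S n =
  Σ (List Carrier) λ xs → Unique xs × (∀ x → x ∈ xs) × length xs ≡ n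
  where
  open Setoid S
  open SetoidMembership S using (_∈_)
  open SetoidUnique S using (Unique)

count : ∀ {a p} {A : Set a} {P : A → Set p} →
        (∀ x → Relation.Nullary.Dec (P x)) → List A → ℕ
count P? xs = length (filter P? xs)

elems : ∀ {m} → Subset m → List (Fin m)
elems {m} S = filter (λ i → i ∈? S) (allFin m)

addMod : ∀ {m} .{{_ : NonZero m}} → Fin m → Fin m → Fin m
addMod {m} i c = (toℕ i ℕ.+ toℕ c) mod m

-- Circular external difference families in a finite abelian group G
-- (G written additively: _∙_ is +, ε is 0, _⁻¹ is negation).
-- Subsets of G are represented by duplicate-free lists.

module _ {c ℓ} (G : AbelianGroup c ℓ) where
  open AbelianGroup G renaming (Carrier to A)
  open SetoidMembership setoid using (_∈_)
  open SetoidUnique setoid using (Unique)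

  minus : A → A → A
  minus a b = a ∙ (b ⁻¹)

  Δ : List A → List A → List A
  Δ xs ys = concatMap (λ x → map (λ y → minus x y) ys) xs

  cedfMultiset : ∀ {m} .{{_ : NonZero m}} → Subset m → (Fin m → List A) → List A
  cedfMultiset {m} S Af =
    concatMap (λ c → concatMap (λ i → Δ (Af (addMod i c)) (Af i)) (allFin m))
              (elems S)

  record IsCEDF (_≟_ : Decidable _≈_) (n m l λ' : ℕ) .{{_ : NonZero m}}
                (S : Subset m) (Af : Fin m → List A) : Set (c ⊔ ℓ) where
    field
      order    : HasSize setoid n
      distinct : ∀ i → Unique (Af i)
      size     : ∀ i → length (Af i) ≡ l
      disjoint : ∀ i j → i ≢ j → ∀ x → x ∈ Af i → ¬ (x ∈ Af j)
      counts   : ∀ g → ¬ (g ≈ ε) → count (λ y → y ≟ g) (cedfMultiset S Af) ≡ λ'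

record IsFiniteField {c ℓ} (F : CommutativeRing c ℓ) (q : ℕ) : Set (c ⊔ ℓ) where
  open CommutativeRing F
  field
    0≉1     : ¬ (0# ≈ 1#)
    inverse : ∀ x → ¬ (x ≈ 0#) → ∃ λ y → x * y ≈ 1#
    _≟_     : Decidable _≈_
    card    : HasSize setoid q

module _ {c ℓ} (F : CommutativeRing c ℓ) where
  open CommutativeRing F
  open RawSemiringDefs (Semiring.rawSemiring semiring) using (_^_)

  IsPrimitive : Carrier → Set (c ⊔ ℓ)
  IsPrimitive θ = ¬ (θ ≈ 0#) × (∀ x → ¬ (x ≈ 0#) → ∃ λ k → x ≈ θ ^ k)

  module _ (θ : Carrier) (m l : ℕ) where
    β : Carrier
    β = θ ^ l

    -- C = ⟨β^m⟩, listed as (β^m)^t for 0 ≤ t ≤ l-1 (its order is l)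
    Cset : List Carrier
    Cset = map (λ t → (β ^ m) ^ toℕ t) (allFin l)

    coset : Carrier → List Carrier
    coset x = map (λ y → x * y) Cset

    Dfam : (Fin m → Fin (m ℕ.* l)) → Fin m → List Carrier
    Dfam σ j = coset (θ ^ toℕ (σ j))

    diffMultiset : .{{_ : NonZero m}} → (Fin m → Fin (m ℕ.* l)) → Subset m → List Carrier
    diffMultiset σ S =
      concatMap (λ c → concatMap (λ j → map (λ r →
          θ ^ toℕ (σ (addMod j c)) - θ ^ toℕ (σ j) * β ^ (m ℕ.* toℕ r))
        (allFin l)) (allFin m)) (elems S)

    CosetCondition : (_≟_ : Decidable _≈_) → .{{_ : NonZero m}} →
                     (Fin m → Fin (m ℕ.* l)) → Subset m → ℕ → Set (c ⊔ ℓ)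
    CosetCondition _≟_ σ S λ' =
      ∀ x → ¬ (x ≈ 0#) → count (λ y → y ∈C? coset x) (diffMultiset σ S) ≡ λ'
      where
      decSetoid : DecSetoid c ℓ
      decSetoid = record { isDecEquivalence = record
                    { isEquivalence = isEquivalence ; _≟_ = _≟_ } }
      open DecSetoidMembership decSetoid renaming (_∈?_ to _∈C?_)

{-# OPTIONS --safe #-}

-- Put γ = β ^ m = θ ^ (l m); since θ has order q - 1 = l m · l, γ has order l, C = {γ ^ t : t < l}
-- and D_j = a_j C with a_j = θ ^ σ(j). For g ≠ 0 the occurrences of g in Δ(D_{j+c}, D_j) are the
-- pairs (s, t) with a_{j+c} γ ^ s - a_j γ ^ t = g. Multiplying by γ ^ (-s) and putting r = t - s,
-- u = -s matches them bijectively with the pairs (r, u) with a_{j+c} - a_j γ ^ r = g γ ^ u, that is,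
-- with the entries a_{j+c} - a_j β ^ (m r) of the multiset that lie in the coset g C. Summing over
-- j and c ∈ S, g occurs in the CEDF multiset exactly as often as the multiset meets g C, so the two
-- conditions coincide. The other CEDF axioms hold because the exponents σ(j) + l m t (t < l) are
-- distinct and below q - 1, and σ(j) is recovered from them modulo l m.
module Submission where

open import Algebra.Bundles using (AbelianGroup; CommutativeRing)
open import Data.Bool using (true; false)
open import Data.Empty using (⊥-elim)
open import Data.Fin as Fin using (Fin; toℕ)
import Data.Fin.Properties as Fin
open import Data.Fin.Subset using (Subset)
open import Data.List
  using (List; []; _∷_; _++_; length; map; filter; concatMap; allFin; cartesianProduct; applyUpTo)
open import Data.List.Properties
  using ( filter-++; filter-none; length-++; length-map; length-applyUpTo; length-removeAt′
        ; length-tabulate; map-∘; map-++)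
open import Data.List.Relation.Unary.All using (All)
open import Data.List.Relation.Unary.AllPairs using (_∷_)
open import Data.List.Relation.Unary.All.Properties using (¬Any⇒All¬; All¬⇒¬Any)
import Data.List.Relation.Unary.All.Properties as Allₚ
open import Data.List.Relation.Unary.Any using (here; there; index)
import Data.List.Relation.Unary.Any.Properties as Anyₚ
import Data.List.Membership.Setoid as SetoidMembership
import Data.List.Membership.Setoid.Properties as SetoidMembershipₚ
import Data.List.Membership.Propositional as PropMembership
import Data.List.Membership.Propositional.Properties as PropMembershipₚ
import Data.List.Relation.Unary.Unique.Setoid as SetoidUnique
import Data.List.Relation.Unary.Unique.Setoid.Properties as SetoidUniqueₚ
import Data.List.Relation.Unary.Unique.Propositional as PropUnique
import Data.List.Relation.Unary.Unique.Propositional.Properties as PropUniqueₚ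
open import Data.Nat as ℕ using (ℕ; zero; suc; _≤_; _<_; z≤n; s≤s; NonZero)
import Data.Nat.Properties as ℕ
open import Data.Nat.DivMod using (_%_; _/_; _mod_; m≡m%n+[m/n]*n; m%n<n; [m+kn]%n≡m%n; m<n⇒m%n≡m)
open import Data.Product using (∃; ∃₂; _×_; _,_; proj₁; proj₂)
open import Function using (_∘_)
open import Function.Definitions using (Injective)
open import Relation.Binary.Bundles using (Setoid)
import Relation.Binary.Reasoning.Setoid
open import Relation.Binary.PropositionalEquality as ≡ using (_≡_; _≢_; cong; cong₂)
open import Relation.Nullary using (¬_; yes; no; does)
open import Relation.Unary using (Pred; Decidable)
open import Relation.Binary.Definitions using (tri<; tri≈; tri>) renaming (Decidable to Decidable₂)

open import Defs

module _ {a ℓ} (S : Setoid a ℓ) where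
  open Setoid S
  open SetoidMembership S using (_∈_; _─_)
  open SetoidUnique S using (Unique)

  private
    ∈-─ : ∀ {x z} ys (x∈ys : x ∈ ys) → z ∈ ys → ¬ z ≈ x → z ∈ ys ─ x∈ys
    ∈-─ (y ∷ ys) (here x≈y)   (here z≈y)   z≉x = ⊥-elim (z≉x (trans z≈y (sym x≈y)))
    ∈-─ (y ∷ ys) (here _)     (there z∈ys) _   = z∈ys
    ∈-─ (y ∷ ys) (there _)    (here z≈y)   _   = here z≈y
    ∈-─ (y ∷ ys) (there x∈ys) (there z∈ys) z≉x = there (∈-─ ys x∈ys z∈ys z≉x)

  Unique⇒length-mono-≤ : ∀ {xs ys} → Unique xs → (∀ {x} → x ∈ xs → x ∈ ys) →
                         length xs ≤ length ys
  Unique⇒length-mono-≤ {[]}     _            _ = z≤n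
  Unique⇒length-mono-≤ {x ∷ xs} {ys} (x∉xs ∷ xs!) xs⊆ys = begin
    suc (length xs)          ≤⟨ s≤s (Unique⇒length-mono-≤ xs! xs⊆ys─x) ⟩
    suc (length (ys ─ x∈ys)) ≡⟨ length-removeAt′ ys (index x∈ys) ⟨
    length ys                ∎
    where
    open ℕ.≤-Reasoning
    x∈ys = xs⊆ys (here refl)
    xs⊆ys─x : ∀ {z} → z ∈ xs → z ∈ ys ─ x∈ys
    xs⊆ys─x z∈xs = ∈-─ ys x∈ys (xs⊆ys (there z∈xs))
      (λ z≈x → All¬⇒¬Any x∉xs (SetoidMembershipₚ.∈-resp-≈ S z≈x z∈xs))

module _ {a p} {A : Set a} {P : Pred A p} (P? : Decidable P) where

  count-++ : ∀ xs ys → count P? (xs ++ ys) ≡ count P? xs ℕ.+ count P? ys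
  count-++ xs ys = ≡.trans (cong length (filter-++ P? xs ys)) (length-++ (filter P? xs))

  count-map : ∀ {b} {B : Set b} (f : B → A) xs → count P? (map f xs) ≡ count (P? ∘ f) xs
  count-map f []       = ≡.refl
  count-map f (x ∷ xs) with does (P? (f x))
  ... | true  = cong suc (count-map f xs)
  ... | false = count-map f xs

  count-none : ∀ {xs} → All (¬_ ∘ P) xs → count P? xs ≡ 0
  count-none ¬Pxs = cong length (filter-none P? ¬Pxs)

module _ {a b p q} {A : Set a} {B : Set b} {P : Pred A p} {Q : Pred B q}
         (P? : Decidable P) (Q? : Decidable Q) where

  count-concatMap : ∀ {i} {I : Set i} {f : I → List A} {g : I → List B} →
    (∀ x → count P? (f x) ≡ count Q? (g x)) →
    ∀ xs → count P? (concatMap f xs) ≡ count Q? (concatMap g xs)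
  count-concatMap         eq []       = ≡.refl
  count-concatMap {f = f} {g} eq (x ∷ xs) = begin
    count P? (f x ++ concatMap f xs)                 ≡⟨ count-++ P? (f x) _ ⟩
    count P? (f x) ℕ.+ count P? (concatMap f xs)     ≡⟨ cong₂ ℕ._+_ (eq x) (count-concatMap eq xs) ⟩
    count Q? (g x) ℕ.+ count Q? (concatMap g xs)     ≡⟨ count-++ Q? (g x) _ ⟨
    count Q? (g x ++ concatMap g xs)                 ∎
    where open ≡.≡-Reasoning

module _ {a b i p q} {A : Set a} {B : Set b} {I : Set i} {P : Pred A p} {Q : Pred (I × B) q}
         (P? : Decidable P) (Q? : Decidable Q) where

  count-cartesianProduct : ∀ (R : I → A) ys →
    (∀ x → count P? (R x ∷ []) ≡ count (Q? ∘ (x ,_)) ys) →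
    ∀ xs → count P? (map R xs) ≡ count Q? (cartesianProduct xs ys)
  count-cartesianProduct R ys eq []       = ≡.refl
  count-cartesianProduct R ys eq (x ∷ xs) = begin
    count P? (R x ∷ map R xs)
      ≡⟨ count-++ P? (R x ∷ []) (map R xs) ⟩
    count P? (R x ∷ []) ℕ.+ count P? (map R xs)
      ≡⟨ cong₂ ℕ._+_ (≡.trans (eq x) (≡.sym (count-map Q? (x ,_) ys)))
                     (count-cartesianProduct R ys eq xs) ⟩
    count Q? (map (x ,_) ys) ℕ.+ count Q? (cartesianProduct xs ys)
      ≡⟨ count-++ Q? (map (x ,_) ys) _ ⟨
    count Q? (map (x ,_) ys ++ cartesianProduct xs ys) ∎
    where open ≡.≡-Reasoning

module _ {a b p q} {A : Set a} {B : Set b} {P : Pred A p} {Q : Pred B q}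
         (P? : Decidable P) (Q? : Decidable Q) where
  open PropMembership using () renaming (_∈_ to _∈ₚ_)

  count-≤-by-injection : ∀ {xs ys} → PropUnique.Unique xs → (∀ y → Q y → y ∈ₚ ys) →
    (φ : A → B) → Injective _≡_ _≡_ φ → (∀ x → P x → Q (φ x)) →
    count P? xs ≤ count Q? ys
  count-≤-by-injection {xs} {ys} xs! Q⊆ys φ φ-inj P⇒Qφ = begin
    count P? xs                   ≡⟨ length-map φ (filter P? xs) ⟨
    length (map φ (filter P? xs)) ≤⟨ Unique⇒length-mono-≤ (≡.setoid B)
                                       (PropUniqueₚ.map⁺ φ-inj (PropUniqueₚ.filter⁺ P? xs!)) φPxs⊆Qys ⟩
    count Q? ys                   ∎
    where
    open ℕ.≤-Reasoning
    φPxs⊆Qys : ∀ {y} → y ∈ₚ map φ (filter P? xs) → y ∈ₚ filter Q? ys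
    φPxs⊆Qys y∈ with PropMembershipₚ.∈-map⁻ φ y∈
    ... | x , x∈ , ≡.refl =
      let Qφx = P⇒Qφ x (proj₂ (PropMembershipₚ.∈-filter⁻ P? {xs = xs} x∈)) in
      PropMembershipₚ.∈-filter⁺ Q? (Q⊆ys _ Qφx) Qφx

module _ {a p q} {A : Set a} {P : Pred A p} {Q : Pred A q}
         (P? : Decidable P) (Q? : Decidable Q)
         {xs : List A} (xs! : PropUnique.Unique xs) (∈xs : ∀ x → x PropMembership.∈ xs) where

  count-≡-by-injections : (φ : A → A) → Injective _≡_ _≡_ φ → (∀ x → P x → Q (φ x)) →
                          (ψ : A → A) → Injective _≡_ _≡_ ψ → (∀ x → Q x → P (ψ x)) →
                          count P? xs ≡ count Q? xs
  count-≡-by-injections φ φ-inj P⇒Qφ ψ ψ-inj Q⇒Pψ = ℕ.≤-antisym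
    (count-≤-by-injection P? Q? xs! (λ y _ → ∈xs y) φ φ-inj P⇒Qφ)
    (count-≤-by-injection Q? P? xs! (λ y _ → ∈xs y) ψ ψ-inj Q⇒Pψ)

module _ {a ℓ} (S : Setoid a ℓ) (_≟_ : Decidable₂ (Setoid._≈_ S)) where
  open Setoid S
  open SetoidMembership S using (_∈_)
  open SetoidUnique S using (Unique)

  count-≈-∉ : ∀ {y zs} → ¬ y ∈ zs → count (y ≟_) zs ≡ 0
  count-≈-∉ y∉zs = count-none (_ ≟_) (¬Any⇒All¬ _ y∉zs)

  count-≈-∈ : ∀ {y zs} → Unique zs → y ∈ zs → count (y ≟_) zs ≡ 1
  count-≈-∈ {y} {z ∷ zs} (z∉zs ∷ zs!) y∈z∷zs with y ≟ z | y∈z∷zs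
  ... | yes y≈z | _          = cong suc (count-≈-∉ λ y∈zs →
                                 All¬⇒¬Any z∉zs (SetoidMembershipₚ.∈-resp-≈ S y≈z y∈zs))
  ... | no  y≉z | here y≈z   = ⊥-elim (y≉z y≈z)
  ... | no  _   | there y∈zs = count-≈-∈ zs! y∈zs

  count-∈?≡count-≈ : ∀ {zs} → Unique zs → (_∈zs? : Decidable (_∈ zs)) →
                     ∀ y → count _∈zs? (y ∷ []) ≡ count (y ≟_) zs
  count-∈?≡count-≈ zs! _∈zs? y with y ∈zs?
  ... | yes y∈zs = ≡.sym (count-≈-∈ zs! y∈zs)
  ... | no  y∉zs = ≡.sym (count-≈-∉ y∉zs)

module FiniteField {c ℓ} (F : CommutativeRing c ℓ) {q} (FF : IsFiniteField F q) where
  open CommutativeRing F renaming (Carrier to K)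
  open IsFiniteField FF
  open import Algebra.Properties.Semiring.Exp semiring using (_^_; ^-congˡ; ^-congʳ; ^-homo-*; ^-assocʳ)
  open import Relation.Binary.Reasoning.Setoid setoid
  open SetoidMembership setoid using (_∈_)
  open SetoidUnique setoid using (Unique)

  *-cancelˡ : ∀ {x y z} → ¬ x ≈ 0# → x * y ≈ x * z → y ≈ z
  *-cancelˡ {x} {y} {z} x≉0 xy≈xz with inverse x x≉0
  ... | x⁻¹ , xx⁻¹≈1 = begin
    y              ≈⟨ *-identityˡ y ⟨
    1# * y         ≈⟨ *-congʳ x⁻¹x≈1 ⟨
    (x⁻¹ * x) * y  ≈⟨ *-assoc x⁻¹ x y ⟩
    x⁻¹ * (x * y)  ≈⟨ *-congˡ xy≈xz ⟩
    x⁻¹ * (x * z)  ≈⟨ *-assoc x⁻¹ x z ⟨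
    (x⁻¹ * x) * z  ≈⟨ *-congʳ x⁻¹x≈1 ⟩
    1# * z         ≈⟨ *-identityˡ z ⟩
    z              ∎
    where
    x⁻¹x≈1 : x⁻¹ * x ≈ 1#
    x⁻¹x≈1 = trans (*-comm x⁻¹ x) xx⁻¹≈1

  *-nonzero : ∀ {x y} → ¬ x ≈ 0# → ¬ y ≈ 0# → ¬ x * y ≈ 0#
  *-nonzero {x} x≉0 y≉0 xy≈0 = y≉0 (*-cancelˡ x≉0 (trans xy≈0 (sym (zeroʳ x))))

  ^-nonzero : ∀ {x} → ¬ x ≈ 0# → ∀ k → ¬ x ^ k ≈ 0#
  ^-nonzero x≉0 zero    1≈0 = 0≉1 (sym 1≈0)
  ^-nonzero x≉0 (suc k) = *-nonzero x≉0 (^-nonzero x≉0 k)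

  1^n≈1 : ∀ n → 1# ^ n ≈ 1#
  1^n≈1 zero    = refl
  1^n≈1 (suc n) = trans (*-identityˡ _) (1^n≈1 n)

  ^-% : ∀ {x e} .{{_ : NonZero e}} → x ^ e ≈ 1# → ∀ k → x ^ k ≈ x ^ (k % e)
  ^-% {x} {e} xᵉ≈1 k = begin
    x ^ k                                ≈⟨ ^-congʳ x (m≡m%n+[m/n]*n k e) ⟩
    x ^ (k % e ℕ.+ (k / e) ℕ.* e)        ≈⟨ ^-homo-* x (k % e) _ ⟩
    x ^ (k % e) * x ^ ((k / e) ℕ.* e)    ≈⟨ *-congˡ (^-congʳ x (ℕ.*-comm (k / e) e)) ⟩
    x ^ (k % e) * x ^ (e ℕ.* (k / e))    ≈⟨ *-congˡ (^-assocʳ x e (k / e)) ⟨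
    x ^ (k % e) * (x ^ e) ^ (k / e)      ≈⟨ *-congˡ (trans (^-congˡ (k / e) xᵉ≈1) (1^n≈1 (k / e))) ⟩
    x ^ (k % e) * 1#                     ≈⟨ *-identityʳ _ ⟩
    x ^ (k % e)                          ∎

  ^-≈⇒^-∸≈1 : ∀ {x i j} → ¬ x ≈ 0# → i ≤ j → x ^ i ≈ x ^ j → x ^ (j ℕ.∸ i) ≈ 1#
  ^-≈⇒^-∸≈1 {x} {i} {j} x≉0 i≤j xⁱ≈xʲ = sym (*-cancelˡ (^-nonzero x≉0 i) (begin
    x ^ i * 1#             ≈⟨ *-identityʳ _ ⟩
    x ^ i                  ≈⟨ xⁱ≈xʲ ⟩
    x ^ j                  ≡⟨ cong (x ^_) (ℕ.m+[n∸m]≡n i≤j) ⟨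
    x ^ (i ℕ.+ (j ℕ.∸ i))  ≈⟨ ^-homo-* x i (j ℕ.∸ i) ⟩
    x ^ i * x ^ (j ℕ.∸ i)  ∎))

  module Primitive {θ : K} (θ-primitive : IsPrimitive F θ) where

    private
      θ≉0 : ¬ θ ≈ 0#
      θ≉0 = proj₁ θ-primitive
      elements : List K
      elements = proj₁ card
      elements! : Unique elements
      elements! = proj₁ (proj₂ card)
      ∈elements : ∀ x → x ∈ elements
      ∈elements = proj₁ (proj₂ (proj₂ card))
      length-elements : length elements ≡ q
      length-elements = proj₂ (proj₂ (proj₂ card))

    -- Every nonzero element is some θ ^ k, hence θ ^ (k % e): F is covered by 0 and e powers.
    θ^e≈1⇒q∸1≤e : ∀ e .{{_ : NonZero e}} → θ ^ e ≈ 1# → q ℕ.∸ 1 ≤ e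
    θ^e≈1⇒q∸1≤e e θᵉ≈1 = ℕ.∸-monoˡ-≤ 1
      (≡.subst₂ _≤_ length-elements (cong suc (length-applyUpTo (θ ^_) e))
        (Unique⇒length-mono-≤ setoid elements! (λ {x} _ → covered x)))
      where
      covered : ∀ x → x ∈ 0# ∷ applyUpTo (θ ^_) e
      covered x with x ≟ 0#
      ... | yes x≈0 = here x≈0
      ... | no  x≉0 with proj₂ θ-primitive x x≉0
      ...   | k , x≈θᵏ = there (Anyₚ.applyUpTo⁺ (θ ^_) (trans x≈θᵏ (^-% θᵉ≈1 k)) (m%n<n k e))

    θⁱ≈θʲ⇒q∸1≤j∸i : ∀ {i j} → i < j → θ ^ i ≈ θ ^ j → q ℕ.∸ 1 ≤ j ℕ.∸ i
    θⁱ≈θʲ⇒q∸1≤j∸i {i} {j} i<j θⁱ≈θʲ =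
      θ^e≈1⇒q∸1≤e (j ℕ.∸ i) (^-≈⇒^-∸≈1 θ≉0 (ℕ.<⇒≤ i<j) θⁱ≈θʲ)
      where
      instance
        j∸i≢0 : NonZero (j ℕ.∸ i)
        j∸i≢0 = ℕ.>-nonZero (ℕ.m<n⇒0<n∸m i<j)

    -- If θ ^ 0, …, θ ^ (q - 1) were pairwise distinct, then together with 0 they would be q + 1
    -- distinct elements; so θ ^ i ≈ θ ^ j for some i < j < q, and then j - i = q - 1.
    θ^[q∸1]≈1 : θ ^ (q ℕ.∸ 1) ≈ 1#
    θ^[q∸1]≈1 with ℕ.anyUpTo? (λ j → ℕ.anyUpTo? (λ i → (θ ^ i) ≟ (θ ^ j)) j) q
    ... | yes (j , j<q , i , i<j , θⁱ≈θʲ) =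
      trans (^-congʳ θ (≡.sym j∸i≡q∸1)) (^-≈⇒^-∸≈1 θ≉0 (ℕ.<⇒≤ i<j) θⁱ≈θʲ)
      where
      j∸i≡q∸1 : j ℕ.∸ i ≡ q ℕ.∸ 1
      j∸i≡q∸1 = ℕ.≤-antisym (ℕ.≤-trans (ℕ.m∸n≤m j i) (ℕ.∸-monoˡ-≤ 1 j<q))
                            (θⁱ≈θʲ⇒q∸1≤j∸i i<j θⁱ≈θʲ)
    ... | no no-repeats = ⊥-elim (ℕ.1+n≰n (≡.subst₂ _≤_
            (cong suc (length-applyUpTo (θ ^_) q)) length-elements
            (Unique⇒length-mono-≤ setoid 0∷powers! (λ {x} _ → ∈elements x))))
      where
      0∷powers! : Unique (0# ∷ applyUpTo (θ ^_) q)
      0∷powers! = Allₚ.applyUpTo⁺₂ (θ ^_) q (λ k 0≈θᵏ → ^-nonzero θ≉0 k (sym 0≈θᵏ))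
                ∷ SetoidUniqueₚ.applyUpTo⁺₁ setoid (θ ^_) q
                    (λ i<j j<q θⁱ≈θʲ → no-repeats (_ , j<q , _ , i<j , θⁱ≈θʲ))

    θ^-injective : ∀ {i j} → i < q ℕ.∸ 1 → j < q ℕ.∸ 1 → θ ^ i ≈ θ ^ j → i ≡ j
    θ^-injective {i} {j} i<q-1 j<q-1 θⁱ≈θʲ with ℕ.<-cmp i j
    ... | tri< i<j _ _ =
      ⊥-elim (ℕ.<⇒≱ j<q-1 (ℕ.≤-trans (θⁱ≈θʲ⇒q∸1≤j∸i i<j θⁱ≈θʲ) (ℕ.m∸n≤m j i)))
    ... | tri≈ _ i≡j _ = i≡j
    ... | tri> _ _ j<i =
      ⊥-elim (ℕ.<⇒≱ i<q-1 (ℕ.≤-trans (θⁱ≈θʲ⇒q∸1≤j∸i j<i (sym θⁱ≈θʲ)) (ℕ.m∸n≤m i j)))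

module _ {c ℓ} (G : AbelianGroup c ℓ) where

  Δ-map : ∀ {i j} {I : Set i} {J : Set j} (f : I → AbelianGroup.Carrier G) g xs (ys : List J) →
    Δ G (map f xs) (map g ys) ≡ map (λ p → minus G (f (proj₁ p)) (g (proj₂ p))) (cartesianProduct xs ys)
  Δ-map f g []       ys = ≡.refl
  Δ-map f g (x ∷ xs) ys = ≡.trans
    (cong₂ _++_ (≡.trans (≡.sym (map-∘ ys)) (map-∘ ys)) (Δ-map f g xs ys))
    (≡.sym (map-++ _ (map (x ,_) ys) (cartesianProduct xs ys)))

module CyclotomicCosets {c ℓ} (F : CommutativeRing c ℓ) {q} (FF : IsFiniteField F q)
                        {θ} (θ-primitive : IsPrimitive F θ)
                        (m l : ℕ) .{{_ : NonZero m}} .{{_ : NonZero l}}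
                        (q∸1≡ml² : q ℕ.∸ 1 ≡ m ℕ.* (l ℕ.* l)) where
  open CommutativeRing F renaming (Carrier to K)
  open IsFiniteField FF
  open FiniteField F FF
  open Primitive θ-primitive
  open import Algebra.Properties.Semiring.Exp semiring using (_^_; ^-congˡ; ^-congʳ; ^-homo-*; ^-assocʳ)
  open import Algebra.Properties.Ring ring using ([y-z]x≈yx-zx)
  open SetoidMembership setoid using (_∈_)
  module ≈-Reasoning = Relation.Binary.Reasoning.Setoid setoid

  instance
    lm≢0 : NonZero (l ℕ.* m)
    lm≢0 = ℕ.m*n≢0 l m

  γ : K
  γ = β F θ m l ^ m

  E : Fin l → K
  E t = γ ^ toℕ t

  lml≡q∸1 : l ℕ.* m ℕ.* l ≡ q ℕ.∸ 1
  lml≡q∸1 = ≡.sym (≡.trans q∸1≡ml² (≡.trans (ℕ.*-comm m (l ℕ.* l))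
              (≡.trans (ℕ.*-assoc l l m) (ℕ.*-comm l (l ℕ.* m)))))

  γ^k≈θ^[lmk] : ∀ k → γ ^ k ≈ θ ^ (l ℕ.* m ℕ.* k)
  γ^k≈θ^[lmk] k = trans (^-congˡ k (^-assocʳ θ l m)) (^-assocʳ θ (l ℕ.* m) k)

  γ^l≈1 : γ ^ l ≈ 1#
  γ^l≈1 = trans (γ^k≈θ^[lmk] l) (trans (^-congʳ θ lml≡q∸1) θ^[q∸1]≈1)

  E-nonzero : ∀ t → ¬ E t ≈ 0#
  E-nonzero t = ^-nonzero (^-nonzero (^-nonzero (proj₁ θ-primitive) l) m) (toℕ t)

  E-injective : ∀ {s t} → E s ≈ E t → s ≡ t
  E-injective {s} {t} Es≈Et = Fin.toℕ-injective (ℕ.*-cancelˡ-≡ (toℕ s) (toℕ t) (l ℕ.* m)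
    (θ^-injective (lm*<q∸1 s) (lm*<q∸1 t)
      (trans (sym (γ^k≈θ^[lmk] (toℕ s))) (trans Es≈Et (γ^k≈θ^[lmk] (toℕ t))))))
    where
    lm*<q∸1 : ∀ (u : Fin l) → l ℕ.* m ℕ.* toℕ u < q ℕ.∸ 1
    lm*<q∸1 u = ℕ.<-≤-trans (ℕ.*-monoʳ-< (l ℕ.* m) (Fin.toℕ<n u)) (ℕ.≤-reflexive lml≡q∸1)

  E-mod : ∀ n → E (n mod l) ≈ γ ^ n
  E-mod n = trans (^-congʳ γ (Fin.toℕ-fromℕ< (m%n<n n l))) (sym (^-% γ^l≈1 n))

  infixl 6 _⊕_

  _⊕_ : Fin l → Fin l → Fin l
  s ⊕ t = (toℕ s ℕ.+ toℕ t) mod l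

  ⊖_ : Fin l → Fin l
  ⊖ t = (l ℕ.∸ toℕ t) mod l

  E-⊕ : ∀ s t → E (s ⊕ t) ≈ E s * E t
  E-⊕ s t = trans (E-mod _) (^-homo-* γ (toℕ s) (toℕ t))

  E-⊖ : ∀ t → E (⊖ t) * E t ≈ 1#
  E-⊖ t = begin
    E (⊖ t) * E t                 ≈⟨ *-congʳ (E-mod _) ⟩
    γ ^ (l ℕ.∸ toℕ t) * γ ^ toℕ t ≈⟨ ^-homo-* γ (l ℕ.∸ toℕ t) (toℕ t) ⟨
    γ ^ (l ℕ.∸ toℕ t ℕ.+ toℕ t)   ≡⟨ cong (γ ^_) (ℕ.m∸n+n≡m (ℕ.<⇒≤ (Fin.toℕ<n t))) ⟩
    γ ^ l                         ≈⟨ γ^l≈1 ⟩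
    1#                            ∎
    where open ≈-Reasoning

  ⊖-injective : ∀ {s t} → ⊖ s ≡ ⊖ t → s ≡ t
  ⊖-injective {s} {t} ⊖s≡⊖t = E-injective (begin
    E s                         ≈⟨ *-identityʳ (E s) ⟨
    E s * 1#                    ≈⟨ *-congˡ (E-⊖ t) ⟨
    E s * (E (⊖ t) * E t)       ≈⟨ *-assoc (E s) _ _ ⟨
    E s * E (⊖ t) * E t         ≡⟨ cong (λ u → E s * E u * E t) ⊖s≡⊖t ⟨
    E s * E (⊖ s) * E t         ≈⟨ *-congʳ (trans (*-comm (E s) _) (E-⊖ s)) ⟩
    1# * E t                    ≈⟨ *-identityˡ (E t) ⟩
    E t                         ∎)
    where open ≈-Reasoning

  ⊕-cancelʳ : ∀ {s t} u → s ⊕ u ≡ t ⊕ u → s ≡ t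
  ⊕-cancelʳ {s} {t} u s⊕u≡t⊕u = E-injective (*-cancelˡ (E-nonzero u)
    (trans (*-comm (E u) (E s)) (trans (sym (E-⊕ s u))
      (trans (reflexive (cong E s⊕u≡t⊕u)) (trans (E-⊕ t u) (*-comm (E t) (E u)))))))

  allFin² : List (Fin l × Fin l)
  allFin² = cartesianProduct (allFin l) (allFin l)

  βᵐʳ≈E : ∀ r → β F θ m l ^ (m ℕ.* toℕ r) ≈ E r
  βᵐʳ≈E r = sym (^-assocʳ (β F θ m l) m (toℕ r))

  module _ (a b g : K) where

    Δ≈g? : Decidable (λ (p : Fin l × Fin l) → a * E (proj₁ p) - b * E (proj₂ p) ≈ g)
    Δ≈g? (s , t) = (a * E s - b * E t) ≟ g

    diffEntry : Fin l → K
    diffEntry r = a - b * β F θ m l ^ (m ℕ.* toℕ r)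

    diffEntry≈gE? : Decidable (λ (p : Fin l × Fin l) → diffEntry (proj₁ p) ≈ g * E (proj₂ p))
    diffEntry≈gE? (r , u) = diffEntry r ≟ (g * E u)

    count-Δ≈g≡count-diffEntry≈gE : count Δ≈g? allFin² ≡ count diffEntry≈gE? allFin²
    count-Δ≈g≡count-diffEntry≈gE = count-≡-by-injections Δ≈g? diffEntry≈gE?
      (PropUniqueₚ.cartesianProduct⁺ (PropUniqueₚ.allFin⁺ l) (PropUniqueₚ.allFin⁺ l))
      (λ (s , t) → PropMembershipₚ.∈-cartesianProduct⁺
                     (PropMembershipₚ.∈-allFin s) (PropMembershipₚ.∈-allFin t))
      φ φ-injective Δ≈g⇒diffEntry≈gE ψ ψ-injective diffEntry≈gE⇒Δ≈g
      where
      φ ψ : Fin l × Fin l → Fin l × Fin l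
      φ (s , t) = t ⊕ ⊖ s , ⊖ s
      ψ (r , u) = ⊖ u , r ⊕ ⊖ u

      φ-injective : Injective _≡_ _≡_ φ
      φ-injective {s , t} {s′ , t′} φ≡ with ⊖-injective {s} {s′} (cong proj₂ φ≡)
      ... | ≡.refl = cong (s ,_) (⊕-cancelʳ (⊖ s) (cong proj₁ φ≡))

      ψ-injective : Injective _≡_ _≡_ ψ
      ψ-injective {r , u} {r′ , u′} ψ≡ with ⊖-injective {u} {u′} (cong proj₁ ψ≡)
      ... | ≡.refl = cong (_, u) (⊕-cancelʳ (⊖ u) (cong proj₂ ψ≡))

      Δ≈g⇒diffEntry≈gE : ∀ p → a * E (proj₁ p) - b * E (proj₂ p) ≈ g →
                         diffEntry (proj₁ (φ p)) ≈ g * E (proj₂ (φ p))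
      Δ≈g⇒diffEntry≈gE (s , t) Δ≈g = begin
        a - b * β F θ m l ^ (m ℕ.* toℕ (t ⊕ ⊖ s)) ≈⟨ +-congˡ (-‿cong (*-congˡ (βᵐʳ≈E (t ⊕ ⊖ s)))) ⟩
        a - b * E (t ⊕ ⊖ s)                       ≈⟨ +-congˡ (-‿cong (*-congˡ (E-⊕ t (⊖ s)))) ⟩
        a - b * (E t * E (⊖ s))                   ≈⟨ +-cong a≈aEsE⊖s (-‿cong (sym (*-assoc b _ _))) ⟩
        a * E s * E (⊖ s) - b * E t * E (⊖ s)     ≈⟨ [y-z]x≈yx-zx _ _ _ ⟨
        (a * E s - b * E t) * E (⊖ s)             ≈⟨ *-congʳ Δ≈g ⟩
        g * E (⊖ s)                               ∎
        where
        open ≈-Reasoning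
        a≈aEsE⊖s : a ≈ a * E s * E (⊖ s)
        a≈aEsE⊖s = begin
          a                      ≈⟨ *-identityʳ a ⟨
          a * 1#                 ≈⟨ *-congˡ (trans (*-comm (E s) _) (E-⊖ s)) ⟨
          a * (E s * E (⊖ s))    ≈⟨ *-assoc a _ _ ⟨
          a * E s * E (⊖ s)      ∎

      diffEntry≈gE⇒Δ≈g : ∀ p → diffEntry (proj₁ p) ≈ g * E (proj₂ p) →
                         a * E (proj₁ (ψ p)) - b * E (proj₂ (ψ p)) ≈ g
      diffEntry≈gE⇒Δ≈g (r , u) dᵣ≈gEᵤ = begin
        a * E (⊖ u) - b * E (r ⊕ ⊖ u)       ≈⟨ +-congˡ (-‿cong (*-congˡ (E-⊕ r (⊖ u)))) ⟩
        a * E (⊖ u) - b * (E r * E (⊖ u))   ≈⟨ +-congˡ (-‿cong (*-assoc b _ _)) ⟨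
        a * E (⊖ u) - b * E r * E (⊖ u)     ≈⟨ [y-z]x≈yx-zx _ _ _ ⟨
        (a - b * E r) * E (⊖ u)             ≈⟨ *-congʳ (+-congˡ (-‿cong (*-congˡ (βᵐʳ≈E r)))) ⟨
        diffEntry r * E (⊖ u)               ≈⟨ *-congʳ dᵣ≈gEᵤ ⟩
        g * E u * E (⊖ u)                   ≈⟨ *-assoc g _ _ ⟩
        g * (E u * E (⊖ u))                 ≈⟨ *-congˡ (trans (*-comm _ _) (E-⊖ u)) ⟩
        g * 1#                              ≈⟨ *-identityʳ g ⟩
        g                                   ∎
        where open ≈-Reasoning

  coset≡map : ∀ x → coset F θ m l x ≡ map (λ t → x * E t) (allFin l)
  coset≡map x = ≡.sym (map-∘ (allFin l))

  coset-Unique : ∀ {x} → ¬ x ≈ 0# → SetoidUnique.Unique setoid (coset F θ m l x)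
  coset-Unique {x} x≉0 = ≡.subst (SetoidUnique.Unique setoid) (≡.sym (coset≡map x))
    (SetoidUniqueₚ.map⁺ (≡.setoid (Fin l)) setoid (λ xEs≈xEt → E-injective (*-cancelˡ x≉0 xEs≈xEt))
      (PropUniqueₚ.allFin⁺ l))

  length-coset : ∀ x → length (coset F θ m l x) ≡ l
  length-coset x = ≡.trans (cong length (coset≡map x))
    (≡.trans (length-map _ (allFin l)) (length-tabulate (λ t → t)))

  count-Δ-coset : ∀ a b {g} → ¬ g ≈ 0# → (∈gC? : Decidable (_∈ coset F θ m l g)) →
    count (_≟ g) (Δ +-abelianGroup (coset F θ m l a) (coset F θ m l b))
      ≡ count ∈gC? (map (diffEntry a b g) (allFin l))
  count-Δ-coset a b {g} g≉0 ∈gC? = begin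
    count (_≟ g) (Δ +-abelianGroup (coset F θ m l a) (coset F θ m l b))
      ≡⟨ cong₂ (λ xs ys → count (_≟ g) (Δ +-abelianGroup xs ys)) (coset≡map a) (coset≡map b) ⟩
    count (_≟ g) (Δ +-abelianGroup (map (λ s → a * E s) (allFin l)) (map (λ t → b * E t) (allFin l)))
      ≡⟨ cong (count (_≟ g)) (Δ-map +-abelianGroup _ _ (allFin l) (allFin l)) ⟩
    count (_≟ g) (map (λ p → a * E (proj₁ p) - b * E (proj₂ p)) allFin²)
      ≡⟨ count-map (_≟ g) _ allFin² ⟩
    count (Δ≈g? a b g) allFin²
      ≡⟨ count-Δ≈g≡count-diffEntry≈gE a b g ⟩
    count (diffEntry≈gE? a b g) allFin²
      ≡⟨ count-cartesianProduct ∈gC? (diffEntry≈gE? a b g) (diffEntry a b g) (allFin l)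
           count-∈gC (allFin l) ⟨
    count ∈gC? (map (diffEntry a b g) (allFin l)) ∎
    where
    open ≡.≡-Reasoning
    count-∈gC : ∀ r → count ∈gC? (diffEntry a b g r ∷ [])
                    ≡ count (diffEntry≈gE? a b g ∘ (r ,_)) (allFin l)
    count-∈gC r = begin
      count ∈gC? (d ∷ [])                             ≡⟨ count-∈?≡count-≈ setoid _≟_ (coset-Unique g≉0) ∈gC? d ⟩
      count (d ≟_) (coset F θ m l g)                  ≡⟨ cong (count (d ≟_)) (coset≡map g) ⟩
      count (d ≟_) (map (λ u → g * E u) (allFin l))   ≡⟨ count-map (d ≟_) _ (allFin l) ⟩
      count (diffEntry≈gE? a b g ∘ (r ,_)) (allFin l) ∎
      where
      d : K
      d = diffEntry a b g r

  module _ (σ : Fin m → Fin (m ℕ.* l)) where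

    count-cedfMultiset : ∀ S {g} → ¬ g ≈ 0# → (∈gC? : Decidable (_∈ coset F θ m l g)) →
      count (_≟ g) (cedfMultiset +-abelianGroup S (Dfam F θ m l σ))
        ≡ count ∈gC? (diffMultiset F θ m l σ S)
    count-cedfMultiset S g≉0 ∈gC? = count-concatMap (_≟ _) ∈gC?
      (λ c → count-concatMap (_≟ _) ∈gC?
        (λ j → count-Δ-coset (θ ^ toℕ (σ (addMod j c))) (θ ^ toℕ (σ j)) g≉0 ∈gC?) (allFin m))
      (elems S)

    private
      exponent : Fin m → Fin l → ℕ
      exponent j t = toℕ (σ j) ℕ.+ l ℕ.* m ℕ.* toℕ t

      σ<lm : ∀ j → toℕ (σ j) < l ℕ.* m
      σ<lm j = ℕ.<-≤-trans (Fin.toℕ<n (σ j)) (ℕ.≤-reflexive (ℕ.*-comm m l))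

      exponent<q∸1 : ∀ j t → exponent j t < q ℕ.∸ 1
      exponent<q∸1 j t = ℕ.<-≤-trans (ℕ.+-monoˡ-< (l ℕ.* m ℕ.* toℕ t) (σ<lm j))
        (ℕ.≤-trans (ℕ.≤-reflexive (≡.sym (ℕ.*-suc (l ℕ.* m) (toℕ t))))
          (ℕ.≤-trans (ℕ.*-monoʳ-≤ (l ℕ.* m) (Fin.toℕ<n t)) (ℕ.≤-reflexive lml≡q∸1)))

      exponent%lm : ∀ j t → exponent j t % (l ℕ.* m) ≡ toℕ (σ j)
      exponent%lm j t = begin
        (toℕ (σ j) ℕ.+ l ℕ.* m ℕ.* toℕ t) % (l ℕ.* m) ≡⟨ cong (λ n → (toℕ (σ j) ℕ.+ n) % (l ℕ.* m))
                                                            (ℕ.*-comm (l ℕ.* m) (toℕ t)) ⟩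
        (toℕ (σ j) ℕ.+ toℕ t ℕ.* (l ℕ.* m)) % (l ℕ.* m) ≡⟨ [m+kn]%n≡m%n (toℕ (σ j)) (toℕ t) (l ℕ.* m) ⟩
        toℕ (σ j) % (l ℕ.* m)                           ≡⟨ m<n⇒m%n≡m (σ<lm j) ⟩
        toℕ (σ j)                                       ∎
        where open ≡.≡-Reasoning

      ∈Dfam⇒≈θ^exponent : ∀ j {x} → x ∈ Dfam F θ m l σ j → ∃ λ t → x ≈ θ ^ exponent j t
      ∈Dfam⇒≈θ^exponent j {x} x∈Dⱼ
        with SetoidMembershipₚ.∈-map⁻ (≡.setoid (Fin l)) setoid (≡.subst (x ∈_) (coset≡map _) x∈Dⱼ)
      ... | t , _ , x≈θ^σⱼEₜ = t , (begin
        x                                       ≈⟨ x≈θ^σⱼEₜ ⟩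
        θ ^ toℕ (σ j) * E t                     ≈⟨ *-congˡ (γ^k≈θ^[lmk] (toℕ t)) ⟩
        θ ^ toℕ (σ j) * θ ^ (l ℕ.* m ℕ.* toℕ t) ≈⟨ ^-homo-* θ (toℕ (σ j)) (l ℕ.* m ℕ.* toℕ t) ⟨
        θ ^ exponent j t                        ∎)
        where open ≈-Reasoning

    Dfam-disjoint : Injective _≡_ _≡_ σ → ∀ i j → i ≢ j → ∀ x →
                    x ∈ Dfam F θ m l σ i → ¬ x ∈ Dfam F θ m l σ j
    Dfam-disjoint σ-injective i j i≢j x x∈Dᵢ x∈Dⱼ
      with ∈Dfam⇒≈θ^exponent i x∈Dᵢ | ∈Dfam⇒≈θ^exponent j x∈Dⱼ
    ... | s , x≈θ^eᵢₛ | t , x≈θ^eⱼₜ = i≢j (σ-injective (Fin.toℕ-injective (begin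
      toℕ (σ i)                   ≡⟨ exponent%lm i s ⟨
      exponent i s % (l ℕ.* m)    ≡⟨ cong (_% (l ℕ.* m)) eᵢₛ≡eⱼₜ ⟩
      exponent j t % (l ℕ.* m)    ≡⟨ exponent%lm j t ⟩
      toℕ (σ j)                   ∎)))
      where
      open ≡.≡-Reasoning
      eᵢₛ≡eⱼₜ : exponent i s ≡ exponent j t
      eᵢₛ≡eⱼₜ = θ^-injective (exponent<q∸1 i s) (exponent<q∸1 j t)
                             (trans (sym x≈θ^eᵢₛ) x≈θ^eⱼₜ)

open import Data.Fin.Subset using (_∈_; Nonempty; ∣_∣)
open import Data.Nat using (_^_; _*_; _∸_)
open import Data.Nat.Primality using (Prime)
open import Function.Bundles using (_⇔_; mk⇔)

theorem4 : ∀ {c ℓ} (F : CommutativeRing c ℓ) (q m l : ℕ) .{{_ : NonZero m}} →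
    (∃₂ λ p k → Prime p × q ≡ p ^ k) →
    (FF : IsFiniteField F q) →
    2 ≤ l → 2 ≤ m → q ∸ 1 ≡ m * (l * l) →
    (θ : CommutativeRing.Carrier F) → IsPrimitive F θ →
    (σ : Fin m → Fin (m * l)) → Injective _≡_ _≡_ σ →
    (S : Subset m) → Nonempty S → (∀ c → c ∈ S → 1 ≤ toℕ c) →
    IsCEDF (CommutativeRing.+-abelianGroup F) (IsFiniteField._≟_ FF)
           q m l (∣ S ∣) S (Dfam F θ m l σ)
      ⇔ CosetCondition F θ m l (IsFiniteField._≟_ FF) σ S (∣ S ∣)
theorem4 F q m l _ FF 2≤l _ q∸1≡ml² θ θ-primitive σ σ-injective S _ _ = mk⇔
  (λ cedf g g≉0 → ≡.trans (≡.sym (count-cedfMultiset σ S g≉0 _)) (IsCEDF.counts cedf g g≉0))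
  (λ cosets → record
    { order    = IsFiniteField.card FF
    ; distinct = λ j → coset-Unique (FiniteField.^-nonzero F FF (proj₁ θ-primitive) (toℕ (σ j)))
    ; size     = λ j → length-coset _
    ; disjoint = Dfam-disjoint σ σ-injective
    ; counts   = λ g g≉0 → ≡.trans (count-cedfMultiset σ S g≉0 _) (cosets g g≉0)
    })
  where
  instance
    l≢0 : NonZero l
    l≢0 = ℕ.>-nonZero (ℕ.<-≤-trans (s≤s z≤n) 2≤l)
  open CyclotomicCosets F FF θ-primitive m l q∸1≡ml²
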